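{- Let $P$ be an acyclic solos term (with respect to some environment $\Gamma$). Then the solo diagram associated with $P$ is an acyclic solo diagram.
   Context: Triadic solos terms: $P ::= 0 \mid u(x_1x_2x_3) \mid \overline{u}\langle x_1x_2x_3\rangle \mid (P\mid P) \mid (\nu x)P$, where $(\nu x)P$ binds $x$; input solo $u(x_1x_2x_3)$, output solo $\overline u\langle x_1x_2x_3\rangle$, subject $u$, object occurrences $x_1,x_2,x_3$. Structural congruence: least congruence containing $\alpha$-equivalence and $0\mid P\equiv P$, $P\mid Q\equiv Q\mid P$, $(P\mid Q)\mid R\equiv P\mid(Q\mid R)$, $(\nu x)(\nu y)P\equiv(\nu y)(\nu x)P$, $(\nu x)0\equiv 0$, $((\nu x)P)\mid Q\equiv(\nu x)(P\mid Q)$ if $x$ not free in $Q$. Reduction: $(\nu \vec z)(\overline u\langle x_1x_2x_3\rangle\mid u(y_1y_2y_3)\mid P)\to P\sigma$ where $\sigma$ is a most general unifier of $x_1x_2x_3$ and $y_1y_2y_3$ such that exactly the names $w$ of $\vec z$ satisfy $\sigma(w)\neq w$; closed under parallel composition, restriction and structural congruence. Types, typing and protocols: types $V,W$; typed terms annotate restrictions $(\nu x^U)P$. $\Gamma\vdash P$ is derived by: $\Gamma\vdash 0$; $\Gamma\vdash P,\Gamma\vdash Q\Rightarrow\Gamma\vdash P\mid Q$; $\Gamma,x:U\vdash P\Rightarrow\Gamma\vdash(\nu x^U)P$; a solo (input or output) with subject $u$ and objects $a,b,c$ is typed by $\Gamma$ iff $\Gamma$ is defined on them and $(\Gamma(u),\Gamma(a),\Gamma(b),\Gamma(c))\in\{(V,W,W,V),(W,W,V,V)\}$.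 Each object occurrence gets a protocol $\mathsf S$ or $\mathsf R$: input with subject of type $V$: $\mathsf R,\mathsf S,\mathsf S$; input, subject type $W$: $\mathsf R,\mathsf S,\mathsf R$; output, subject type $V$: $\mathsf S,\mathsf R,\mathsf R$; output, subject type $W$: $\mathsf S,\mathsf R,\mathsf S$. Relations on solos $s,t$ of $P$ (bound names chosen pairwise distinct and distinct from free names): $x\in s$ iff $x$ has an object occurrence in $s$; $s\triangleleft x$ iff $x$ has an $\mathsf R$-occurrence in $s$; $s\triangleleft t$ iff $s\triangleleft\mathrm{subj}(t)$; $s\perp t$ iff same subject and opposite polarities; $s$ is a root iff no $t$ has $t\triangleleft s$; $\triangleleft^\star$ is the reflexive transitive closure. $P$ is an acyclic solos term w.r.t. $\Gamma$ if $\Gamma\vdash P$ and: (AC1) each name has at most one $\mathsf R$-occurrence; (AC2) $s\perp t$ implies $s,t$ are roots; (AC3) $s\triangleleft x$ and $x\in t$ imply $s\triangleleft^\star t$; (AC4) if $x$ has an $\mathsf S$-occurrence in $s$ and $s\triangleleft x$ then $s$ is an input; (AC5) no free name has an $\mathsf R$-occurrence. Solo diagrams: a finite set of nodes, each tagged free or bound, and a finite multiset of multiedges, each tagged input or output, each having a list of three source nodes and one target node; every node is a source or target of some multiedge. The diagram of a term $P$ (bound names distinct): one node per name occurring in $P$ (free iff the name is free in $P$), one multiedge per solo, from $[x_1,x_2,x_3]$ to $u$, input or output like the solo. Reduction of a diagram $G$: pick dual multiedges $e_1,e_2$ (opposite polarities, same target) with sources $[n_1,n_2,n_3]$ and $[m_1,m_2,m_3]$;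 erase them and add three undirected identification edges $\{n_i,m_i\}$ ($i=1,2,3$; loops and parallel edges allowed); let $I(G;e_1,e_2)$ be the multigraph on the nodes of $G$ with exactly these three edges. Then repeatedly contract an identification edge, identifying its endpoints provided at least one is bound (the resulting node is free iff one of them was free); the step succeeds if all identification edges are eliminated; nodes no longer source or target of a multiedge are removed. The pair $e_1,e_2$ is an acyclic redex if this reduction succeeds (never identifying two free nodes) and $I(G;e_1,e_2)$ is acyclic (no cycle, in particular no loop and no pair of parallel edges). A solo diagram $G$ is acyclic if, for every diagram $H$ reachable from $G$ by finitely many (zero or more) reduction steps, every pair of dual multiedges of $H$ is an acyclic redex. -}

module Defs where

open import Data.Nat using (ℕ; _≟_)
open import Data.Fin using (Fin; zero; suc)
open import Data.Bool using (Bool; true; false; if_then_else_)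
open import Data.Maybe using (Maybe; just; nothing)
import Data.Maybe as Maybe
open import Data.List using (List; []; _∷_; _++_; map; filter; length; lookup; removeAt)
open import Data.List.Membership.Propositional using (_∈_; _∉_)
open import Data.List.Membership.DecPropositional _≟_ using (_∈?_)
open import Data.List.Relation.Unary.Unique.Propositional using (Unique)
open import Data.Product using (Σ; ∃; ∃-syntax; _×_; _,_)
open import Data.Sum using (_⊎_)
open import Relation.Nullary using (¬_; ¬?; does)
open import Relation.Binary.PropositionalEquality using (_≡_; _≢_)
open import Relation.Binary.Construct.Closure.ReflexiveTransitive using (Star)

data Ty : Set where
  V W : Ty

data Pol : Set where
  inp out : Pol

-- solo pol u x1 x2 x3 : input u(x1x2x3) or output ū⟨x1x2x3⟩
data Term : Set where
  nil  : Term
  solo : Pol → ℕ → ℕ → ℕ → ℕ → Term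
  par  : Term → Term → Term
  nu   : ℕ → Ty → Term → Term

fv : Term → List ℕ
fv nil                  = []
fv (solo _ u a b c)     = u ∷ a ∷ b ∷ c ∷ []
fv (par P Q)            = fv P ++ fv Q
fv (nu x _ P)           = filter (λ y → ¬? (y ≟ x)) (fv P)

bnames : Term → List ℕ
bnames nil          = []
bnames (solo _ _ _ _ _) = []
bnames (par P Q)    = bnames P ++ bnames Q
bnames (nu x _ P)   = x ∷ bnames P

WellNamed : Term → Set
WellNamed P = Unique (bnames P) × (∀ x → x ∈ bnames P → x ∉ fv P)

Env : Set
Env = ℕ → Maybe Ty

_[_↦_] : Env → ℕ → Ty → Env
(Γ [ x ↦ U ]) y = if does (y ≟ x) then just U else Γ y

data OkTy : Ty → Ty → Ty → Ty → Set where
  okV : OkTy V W W V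
  okW : OkTy W W V V

data _⊢_ : Env → Term → Set where
  t-nil  : ∀ {Γ} → Γ ⊢ nil
  t-par  : ∀ {Γ P Q} → Γ ⊢ P → Γ ⊢ Q → Γ ⊢ par P Q
  t-nu   : ∀ {Γ x U P} → (Γ [ x ↦ U ]) ⊢ P → Γ ⊢ nu x U P
  t-solo : ∀ {Γ p u a b c tu ta tb tc} →
           Γ u ≡ just tu → Γ a ≡ just ta → Γ b ≡ just tb → Γ c ≡ just tc →
           OkTy tu ta tb tc → Γ ⊢ solo p u a b c

record Solo : Set where
  constructor mkSolo
  field
    pol  : Pol
    subj : ℕ
    o₁ o₂ o₃ : ℕ
open Solo public

obj : Solo → Fin 3 → ℕ
obj s zero             = o₁ s
obj s (suc zero)       = o₂ s
obj s (suc (suc zero)) = o₃ s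

solos : Term → List Solo
solos nil                = []
solos (solo p u a b c)   = mkSolo p u a b c ∷ []
solos (par P Q)          = solos P ++ solos Q
solos (nu _ _ P)         = solos P

tsolos : Env → Term → List (Solo × Maybe Ty)
tsolos Γ nil              = []
tsolos Γ (solo p u a b c) = (mkSolo p u a b c , Γ u) ∷ []
tsolos Γ (par P Q)        = tsolos Γ P ++ tsolos Γ Q
tsolos Γ (nu x U P)       = tsolos (Γ [ x ↦ U ]) P

data Prot : Set where
  S R : Prot

prot : Pol → Ty → Fin 3 → Prot
prot inp V zero = R
prot inp V (suc zero) = S
prot inp V (suc (suc zero)) = S
prot inp W zero = R
prot inp W (suc zero) = S
prot inp W (suc (suc zero)) = R
prot out V zero = S
prot out V (suc zero) = R
prot out V (suc (suc zero)) = R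
prot out W zero = S
prot out W (suc zero) = R
prot out W (suc (suc zero)) = S

protOf : Solo × Maybe Ty → Fin 3 → Maybe Prot
protOf (s , t) i = Maybe.map (λ ty → prot (pol s) ty i) t

-- Relations on solos of a term (solos are indices into the list L)

module Rel (L : List (Solo × Maybe Ty)) where

  Ix : Set
  Ix = Fin (length L)

  sol : Ix → Solo
  sol s = Data.Product.proj₁ (lookup L s)

  Occ : Prot → Ix → Fin 3 → ℕ → Set
  Occ π s i x = obj (sol s) i ≡ x × protOf (lookup L s) i ≡ just π

  _∈ₛ_ : ℕ → Ix → Set
  x ∈ₛ s = ∃[ i ] obj (sol s) i ≡ x

  _◁_ : Ix → ℕ → Set
  s ◁ x = ∃[ i ] Occ R s i x

  _◁ₛ_ : Ix → Ix → Set
  s ◁ₛ t = s ◁ subj (sol t)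

  _⊥_ : Ix → Ix → Set
  s ⊥ t = subj (sol s) ≡ subj (sol t) × pol (sol s) ≢ pol (sol t)

  Root : Ix → Set
  Root s = ∀ t → ¬ (t ◁ₛ s)

  _◁⋆_ : Ix → Ix → Set
  _◁⋆_ = Star _◁ₛ_

  AC1 AC2 AC3 AC4 : Set
  AC1 = ∀ x s i t j → Occ R s i x → Occ R t j x → s ≡ t × i ≡ j
  AC2 = ∀ s t → s ⊥ t → Root s × Root t
  AC3 = ∀ s x t → s ◁ x → x ∈ₛ t → s ◁⋆ t
  AC4 = ∀ s x → (∃[ i ] Occ S s i x) → s ◁ x → pol (sol s) ≡ inp

  AC5 : List ℕ → Set
  AC5 free = ∀ x → x ∈ free → ∀ s i → ¬ Occ R s i x

AcyclicTerm : Env → Term → Set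
AcyclicTerm Γ P = Γ ⊢ P × AC1 × AC2 × AC3 × AC4 × AC5 (fv P)
  where open Rel (tsolos Γ P)

-- Nodes are labelled by natural numbers; the node set of
-- a diagram is the set of labels occurring in its multiedges (so every
-- node is a source or target of some multiedge, and nodes no longer
-- incident to any multiedge disappear automatically).  isFree tags each
-- node free (true) or bound (false).

record Edge : Set where
  constructor mkEdge
  field
    epol : Pol
    src₁ src₂ src₃ : ℕ
    tgt  : ℕ
open Edge public

record Diagram : Set where
  constructor mkD
  field
    edges  : List Edge
    isFree : ℕ → Bool
open Diagram public

soloEdge : Solo → Edge
soloEdge s = mkEdge (pol s) (o₁ s) (o₂ s) (o₃ s) (subj s)

-- the diagram of a term (with distinct bound names)
diagramOf : Term → Diagram
diagramOf P = mkD (map soloEdge (solos P)) (λ x → does (x ∈? fv P))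

Dual : Edge → Edge → Set
Dual e₁ e₂ = tgt e₁ ≡ tgt e₂ × epol e₁ ≢ epol e₂

idEdges : Edge → Edge → List (ℕ × ℕ)
idEdges e₁ e₂ = (src₁ e₁ , src₁ e₂) ∷ (src₂ e₁ , src₂ e₂) ∷ (src₃ e₁ , src₃ e₂) ∷ []

ren : ℕ → ℕ → ℕ → ℕ
ren a b x = if does (x ≟ a) then b else x

renE : ℕ → ℕ → Edge → Edge
renE a b (mkEdge p x y z t) = mkEdge p (ren a b x) (ren a b y) (ren a b z) (ren a b t)

renP : ℕ → ℕ → ℕ × ℕ → ℕ × ℕ
renP a b (x , y) = (ren a b x , ren a b y)

State : Set
State = List Edge × List (ℕ × ℕ)

data Contract (fr : ℕ → Bool) : State → State → Set where
  c-loop  : ∀ {es ids a} (k : Fin (length ids)) → lookup ids k ≡ (a , a) →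
            Contract fr (es , ids) (es , removeAt ids k)
  c-left  : ∀ {es ids a b} (k : Fin (length ids)) → lookup ids k ≡ (a , b) →
            fr a ≡ false →
            Contract fr (es , ids) (map (renE a b) es , map (renP a b) (removeAt ids k))
  c-right : ∀ {es ids a b} (k : Fin (length ids)) → lookup ids k ≡ (a , b) →
            fr b ≡ false →
            Contract fr (es , ids) (map (renE b a) es , map (renP b a) (removeAt ids k))

Succeeds : (ℕ → Bool) → List Edge → List (ℕ × ℕ) → List Edge → Set
Succeeds fr es ids es' = Star (Contract fr) (es , ids) (es' , [])

data DStep : Diagram → Diagram → Set where
  dstep : ∀ {fr} A e₁ B e₂ C {es'} → Dual e₁ e₂ →
          Succeeds fr (A ++ B ++ C) (idEdges e₁ e₂) es' →
          DStep (mkD (A ++ e₁ ∷ B ++ e₂ ∷ C) fr) (mkD es' fr)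

Joins : ℕ × ℕ → ℕ → ℕ → Set
Joins (a , b) u v = (a ≡ u × b ≡ v) ⊎ (a ≡ v × b ≡ u)

data Trail (E : List (ℕ × ℕ)) : ℕ → ℕ → List (Fin (length E)) → Set where
  [] : ∀ {v} → Trail E v v []
  _∷_ : ∀ {u v w is} {i : Fin (length E)} → Joins (lookup E i) u v →
        Trail E v w is → Trail E u w (i ∷ is)

HasCycle : List (ℕ × ℕ) → Set
HasCycle E = ∃[ v ] ∃[ i ] ∃[ is ] (Trail E v v (i ∷ is) × Unique (i ∷ is))

AcyclicRedex : (ℕ → Bool) → List Edge → Edge → List Edge → Edge → List Edge → Set
AcyclicRedex fr A e₁ B e₂ C =
  (∃[ es' ] Succeeds fr (A ++ B ++ C) (idEdges e₁ e₂) es') × ¬ HasCycle (idEdges e₁ e₂)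

AcyclicDiagram : Diagram → Set
AcyclicDiagram G = ∀ H → Star DStep G H →
  ∀ A e₁ B e₂ C → edges H ≡ A ++ e₁ ∷ B ++ e₂ ∷ C → Dual e₁ e₂ →
  AcyclicRedex (isFree H) A e₁ B e₂ C

module Submission where

-- The multiedges of every diagram reachable from that of P are tracked as
-- the image of a list L of typed solos satisfying an invariant: one global
-- typing T of names types every entry, AC1-AC4 hold, and no free name has
-- an R-occurrence.  A simulation lemma shows that the invariant survives
-- deleting entries and renaming names, provided owned names (those with an
-- R-occurrence) are neither moved nor merged into and no kept solo points
-- to a deleted one.  Its instances, merging two unowned names of equal type
-- and deleting a root, cover a whole reduction step: dual solos are roots
-- (AC2) and their identification edges join unowned names of equal type.
-- Under the invariant each position of a dual pair has a unique
-- R-occurrence, its pivot; pivots are bound and distinct, so contraction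
-- succeeds, and a cycle of identification edges would make two solos of
-- different polarity inputs (AC1, AC3, AC4).  The initial invariant comes
-- from the typing derivation, as bound names are distinct.

open import Defs
open import Data.Nat using (ℕ; _≟_)
open import Data.Fin using (Fin; zero; suc)
open import Data.Fin.Properties using (suc-injective)
open import Data.Bool using (Bool; true; false; if_then_else_)
open import Data.Maybe using (Maybe; just; fromMaybe)
import Data.Maybe as Maybe
open import Data.List using (List; []; _∷_; _++_; map; length; lookup; removeAt)
open import Data.List.Properties using (map-++; ∷-injective; ++-assoc)
open import Data.List.Membership.Propositional using (_∈_; _∉_)
open import Data.List.Membership.DecPropositional _≟_ using (_∈?_)
open import Data.List.Membership.Propositional.Properties using (∈-++⁺ˡ; ∈-++⁺ʳ; ∈-++⁻; ∈-∃++; ∈-filter⁺; ∈-lookup)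
open import Data.List.Relation.Unary.Any using (here; there)
open import Data.List.Relation.Unary.All using (All; []; _∷_)
import Data.List.Relation.Unary.All as All
open import Data.List.Relation.Unary.All.Properties using (++⁺; gmap⁺)
open import Data.List.Relation.Unary.AllPairs using (AllPairs; []; _∷_)
open import Data.List.Relation.Unary.Unique.Propositional using (Unique)
open import Data.Product using (∃-syntax; _×_; _,_; proj₁; proj₂)
open import Data.Sum using (_⊎_; inj₁; inj₂)
open import Data.Empty using (⊥-elim)
open import Relation.Nullary using (¬_; yes; no; does; ¬?)
open import Relation.Nullary.Decidable using (dec-true; dec-false; toSum)
open import Relation.Binary.PropositionalEquality using (_≡_; _≢_; refl; sym; trans; cong; cong₂; subst; module ≡-Reasoning)
open import Relation.Binary.Construct.Closure.ReflexiveTransitive using (Star; ε; _◅_)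

TypedList : Set
TypedList = List (Solo × Maybe Ty)

edgeOf : Solo × Maybe Ty → Edge
edgeOf e = soloEdge (proj₁ e)

module _ {A B : Set} (g : A → B) where

  mapIx : ∀ xs → Fin (length (map g xs)) → Fin (length xs)
  mapIx (x ∷ xs) zero    = zero
  mapIx (x ∷ xs) (suc k) = suc (mapIx xs k)

  mapIx⁻ : ∀ xs → Fin (length xs) → Fin (length (map g xs))
  mapIx⁻ (x ∷ xs) zero    = zero
  mapIx⁻ (x ∷ xs) (suc k) = suc (mapIx⁻ xs k)

  lookup-mapIx : ∀ xs k → lookup (map g xs) k ≡ g (lookup xs (mapIx xs k))
  lookup-mapIx (x ∷ xs) zero    = refl
  lookup-mapIx (x ∷ xs) (suc k) = lookup-mapIx xs k

  mapIx-injective : ∀ xs a b → mapIx xs a ≡ mapIx xs b → a ≡ b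
  mapIx-injective (x ∷ xs) zero    zero    e = refl
  mapIx-injective (x ∷ xs) (suc a) (suc b) e = cong suc (mapIx-injective xs a b (suc-injective e))

  mapIx-mapIx⁻ : ∀ xs j → mapIx xs (mapIx⁻ xs j) ≡ j
  mapIx-mapIx⁻ (x ∷ xs) zero    = refl
  mapIx-mapIx⁻ (x ∷ xs) (suc j) = cong suc (mapIx-mapIx⁻ xs j)

module _ {A : Set} {p : A} {Y : List A} where

  skipIx : (X : List A) → Fin (length (X ++ Y)) → Fin (length (X ++ p ∷ Y))
  skipIx []      k       = suc k
  skipIx (x ∷ X) zero    = zero
  skipIx (x ∷ X) (suc k) = suc (skipIx X k)

  holeIx : (X : List A) → Fin (length (X ++ p ∷ Y))
  holeIx []      = zero
  holeIx (x ∷ X) = suc (holeIx X)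

  lookup-hole : (X : List A) → lookup (X ++ p ∷ Y) (holeIx X) ≡ p
  lookup-hole []      = refl
  lookup-hole (x ∷ X) = lookup-hole X

  lookup-skip : (X : List A) (k : Fin (length (X ++ Y))) → lookup (X ++ p ∷ Y) (skipIx X k) ≡ lookup (X ++ Y) k
  lookup-skip []      k       = refl
  lookup-skip (x ∷ X) zero    = refl
  lookup-skip (x ∷ X) (suc k) = lookup-skip X k

  skip-injective : (X : List A) (i j : Fin (length (X ++ Y))) → skipIx X i ≡ skipIx X j → i ≡ j
  skip-injective []      i       j       e = suc-injective e
  skip-injective (x ∷ X) zero    zero    e = refl
  skip-injective (x ∷ X) (suc i) (suc j) e = cong suc (skip-injective X i j (suc-injective e))

  skip≢hole : (X : List A) (k : Fin (length (X ++ Y))) → skipIx X k ≢ holeIx X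
  skip≢hole []      k       ()
  skip≢hole (x ∷ X) zero    ()
  skip≢hole (x ∷ X) (suc k) e = skip≢hole X k (suc-injective e)

  hole-or-skip : (X : List A) (j : Fin (length (X ++ p ∷ Y))) → j ≡ holeIx X ⊎ ∃[ k ] skipIx X k ≡ j
  hole-or-skip []      zero    = inj₁ refl
  hole-or-skip []      (suc j) = inj₂ (j , refl)
  hole-or-skip (x ∷ X) zero    = inj₂ (zero , refl)
  hole-or-skip (x ∷ X) (suc j) with hole-or-skip X j
  ... | inj₁ e       = inj₁ (cong suc e)
  ... | inj₂ (k , e) = inj₂ (suc k , cong suc e)

module _ {A : Set} {p q : A} {Z : List A} where

  hole₂Ix : (X Y : List A) → Fin (length (X ++ p ∷ Y ++ q ∷ Z))
  hole₂Ix []      Y = suc (holeIx Y)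
  hole₂Ix (x ∷ X) Y = suc (hole₂Ix X Y)

  lookup-hole₂ : (X Y : List A) → lookup (X ++ p ∷ Y ++ q ∷ Z) (hole₂Ix X Y) ≡ q
  lookup-hole₂ []      Y = lookup-hole Y
  lookup-hole₂ (x ∷ X) Y = lookup-hole₂ X Y

map-split : ∀ {A B : Set} (g : A → B) (xs : List A) {U b V} → map g xs ≡ U ++ b ∷ V →
            ∃[ U' ] ∃[ a ] ∃[ V' ] (xs ≡ U' ++ a ∷ V' × map g U' ≡ U × g a ≡ b × map g V' ≡ V)
map-split g (x ∷ xs) {[]}    refl = [] , x , xs , refl , refl , refl , refl
map-split g (x ∷ xs) {u ∷ U} eq with ∷-injective eq
... | refl , eq' with map-split g xs eq'
...   | U' , a , V' , refl , refl , e₁ , e₂ = x ∷ U' , a , V' , refl , refl , e₁ , e₂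

All-lookup : ∀ {A : Set} {P : A → Set} {xs} → All P xs → ∀ k → P (lookup xs k)
All-lookup al k = All.lookup al (∈-lookup k)

All-removeAt : ∀ {A : Set} {P : A → Set} {xs} → All P xs → ∀ k → All P (removeAt xs k)
All-removeAt (_ ∷ ps)  zero    = ps
All-removeAt (px ∷ ps) (suc k) = px ∷ All-removeAt ps k

star-last : ∀ {A : Set} {_~_ : A → A → Set} {a b} → Star _~_ a b → a ≡ b ⊎ ∃[ c ] c ~ b
star-last ε = inj₁ refl
star-last (r ◅ p) with star-last p
... | inj₁ refl = inj₂ (_ , r)
... | inj₂ c    = inj₂ c

ren-self : ∀ a b → ren a b a ≡ b
ren-self a b = cong (λ c → if c then b else a) (dec-true (a ≟ a) refl)

ren-other : ∀ a b x → x ≢ a → ren a b x ≡ x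
ren-other a b x x≢a = cong (λ c → if c then b else x) (dec-false (x ≟ a) x≢a)

ren-cases : ∀ a b x → (x ≡ a × ren a b x ≡ b) ⊎ (x ≢ a × ren a b x ≡ x)
ren-cases a b x with x ≟ a
... | yes refl = inj₁ (refl , ren-self a b)
... | no x≢a   = inj₂ (x≢a , ren-other a b x x≢a)

Typed : (ℕ → Ty) → Solo → Set
Typed T s = OkTy (T (subj s)) (T (o₁ s)) (T (o₂ s)) (T (o₃ s))

TypedEntry : (ℕ → Ty) → Solo × Maybe Ty → Set
TypedEntry T (s , m) = m ≡ just (T (subj s)) × Typed T s

Owned : TypedList → ℕ → Set
Owned L x = ∃[ s ] ∃[ i ] Rel.Occ L R s i x

record Invariant (T : ℕ → Ty) (fr : ℕ → Bool) (L : TypedList) : Set where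
  open Rel L
  field
    typed : ∀ k → TypedEntry T (lookup L k)
    ac1   : AC1
    ac2   : AC2
    ac3   : AC3
    ac4   : AC4
    ac5   : ∀ x → fr x ≡ true → ∀ s i → ¬ Occ R s i x

root-unowned : ∀ L k → Rel.Root L k → ¬ Owned L (subj (Rel.sol L k))
root-unowned L k root (s , i , o) = root s (i , o)

-- A name occurring in a root solo k can only be owned by k itself: by AC3
-- its owner reaches k, and a non-trivial path would end in a solo owning
-- the subject of k.
root-name-owner : ∀ {T fr L} → Invariant T fr L → ∀ s i x k → Rel.Occ L R s i x →
                  Rel._∈ₛ_ L x k → ¬ Owned L (subj (Rel.sol L k)) → s ≡ k
root-name-owner I s i x k o x∈k k-root with star-last (Invariant.ac3 I s x k (i , o) x∈k)
... | inj₁ s≡k            = s≡k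
... | inj₂ (c , (i' , o')) = ⊥-elim (k-root (c , i' , o'))

renSolo : (ℕ → ℕ) → Solo → Solo
renSolo ρ s = mkSolo (pol s) (ρ (subj s)) (ρ (o₁ s)) (ρ (o₂ s)) (ρ (o₃ s))

renEntry : (ℕ → ℕ) → Solo × Maybe Ty → Solo × Maybe Ty
renEntry ρ (s , m) = renSolo ρ s , m

obj-renSolo : ∀ ρ s i → obj (renSolo ρ s) i ≡ ρ (obj s i)
obj-renSolo ρ s zero             = refl
obj-renSolo ρ s (suc zero)       = refl
obj-renSolo ρ s (suc (suc zero)) = refl

module Simulation (T : ℕ → Ty) (fr : ℕ → Bool) (L L' : TypedList)
                  (ι : Fin (length L') → Fin (length L)) (ρ : ℕ → ℕ)
                  (lookup-ι : ∀ k → lookup L' k ≡ renEntry ρ (lookup L (ι k)))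
                  (ι-injective : ∀ a b → ι a ≡ ι b → a ≡ b)
                  (ρ-fixes-owned : ∀ x → Owned L x → ρ x ≡ x)
                  (ρ-reflects-owned : ∀ y x → ρ y ≡ x → Owned L x → y ≡ x)
                  (ρ-typed : ∀ x → T (ρ x) ≡ T x)
                  (ι-closed : ∀ k b → Rel._◁ₛ_ L (ι k) b → ∃[ b' ] ι b' ≡ b) where
  module O = Rel L
  module N = Rel L'

  sol-ι : ∀ k → N.sol k ≡ renSolo ρ (O.sol (ι k))
  sol-ι k rewrite lookup-ι k = refl

  prot-ι : ∀ k i → protOf (lookup L' k) i ≡ protOf (lookup L (ι k)) i
  prot-ι k i rewrite lookup-ι k = refl

  subj-ι : ∀ k → subj (N.sol k) ≡ ρ (subj (O.sol (ι k)))
  subj-ι k = cong subj (sol-ι k)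

  pol-ι : ∀ k → pol (N.sol k) ≡ pol (O.sol (ι k))
  pol-ι k = cong pol (sol-ι k)

  obj-ι : ∀ k i → obj (N.sol k) i ≡ ρ (obj (O.sol (ι k)) i)
  obj-ι k i = trans (cong (λ s → obj s i) (sol-ι k)) (obj-renSolo ρ (O.sol (ι k)) i)

  occ-back : ∀ {π k i z} → N.Occ π k i z →
             O.Occ π (ι k) i (obj (O.sol (ι k)) i) × ρ (obj (O.sol (ι k)) i) ≡ z
  occ-back {k = k} {i} (e , p) = (refl , trans (sym (prot-ι k i)) p) , trans (sym (obj-ι k i)) e

  occ-forth : ∀ {π k i x} → O.Occ π (ι k) i x → N.Occ π k i (ρ x)
  occ-forth {k = k} {i} (e , p) = trans (obj-ι k i) (cong ρ e) , trans (prot-ι k i) p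

  -- R-occurrences are reflected without renaming, since owned names are fixed.
  own-back : ∀ {k i z} → N.Occ R k i z → O.Occ R (ι k) i z
  own-back {k} {i} o with occ-back o
  ... | o' , e = subst (O.Occ R (ι k) i) (trans (sym (ρ-fixes-owned _ (ι k , i , o'))) e) o'

  owned-back : ∀ {z} → Owned L' z → Owned L z
  owned-back (k , i , o) = ι k , i , own-back o

  points-back : ∀ {a t} → a N.◁ₛ t → (ι a O.◁ₛ ι t) × ρ (subj (O.sol (ι t))) ≡ subj (O.sol (ι t))
  points-back {a} {t} (i , o) =
    let o' = own-back (subst (N.Occ R a i) (subj-ι t) o)
        q  = ρ-reflects-owned (subj (O.sol (ι t))) _ refl (ι a , i , o')
    in (i , subst (O.Occ R (ι a) i) (sym q) o') , sym q

  points-forth : ∀ {a b} → ι a O.◁ₛ ι b → a N.◁ₛ b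
  points-forth {a} {b} (i , o) = i , subst (N.Occ R a i) (sym (subj-ι b)) (occ-forth o)

  paths-forth : ∀ {a b} → a O.◁⋆ b → ∀ a' → ι a' ≡ a → ∃[ b' ] ι b' ≡ b × a' N.◁⋆ b'
  paths-forth ε a' e = a' , e , ε
  paths-forth (_◅_ {j = c} r p) a' refl with ι-closed a' c r
  ... | c' , refl with paths-forth p c' refl
  ...   | b' , e , q = b' , e , (points-forth r ◅ q)

  -- A solo of L' dual to another is a root: if something pointed to it, its
  -- subject would be owned, hence not merged, so the originals are dual in L.
  dual-root : ∀ s t → subj (N.sol s) ≡ subj (N.sol t) → pol (N.sol s) ≢ pol (N.sol t) →
              O.AC2 → N.Root s
  dual-root s t same-subj diff-pol ac2 a a◁s with points-back a◁s
  ... | r , fixed =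
    let us = subj (O.sol (ι s)); ut = subj (O.sol (ι t))
        ρut : ρ ut ≡ us
        ρut = trans (sym (trans (sym (subj-ι s)) (trans same-subj (subj-ι t)))) fixed
        ut≡us : ut ≡ us
        ut≡us = ρ-reflects-owned ut us ρut (ι a , r)
        dual : ι s O.⊥ ι t
        dual = sym ut≡us , λ q → diff-pol (trans (pol-ι s) (trans q (sym (pol-ι t))))
    in proj₁ (ac2 (ι s) (ι t) dual) (ι a) r

  typed-ι : Invariant T fr L → ∀ k → TypedEntry T (lookup L' k)
  typed-ι I k rewrite lookup-ι k with lookup L (ι k) | Invariant.typed I (ι k)
  ... | (mkSolo p u a b c , m) | (e , ty) rewrite ρ-typed u | ρ-typed a | ρ-typed b | ρ-typed c = e , ty

  -- An owned x occurring in t is not renamed, so AC3 in L gives a path,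
  -- which stays among kept solos.
  ac3-ι : Invariant T fr L → N.AC3
  ac3-ι I s x t (i , or) (j , mem) =
    let or' = own-back or
        q   = ρ-reflects-owned _ x (trans (sym (obj-ι t j)) mem) (ι s , i , or')
        path = Invariant.ac3 I (ι s) x (ι t) (i , or') (j , q)
        (b' , eb , path') = paths-forth path s refl
    in subst (N._◁⋆_ s) (ι-injective b' t eb) path'

  ac4-ι : Invariant T fr L → N.AC4
  ac4-ι I s x (i , os) (j , or) =
    let or' = own-back or
        (os' , e) = occ-back os
        q = ρ-reflects-owned _ x e (ι s , j , or')
    in trans (pol-ι s) (Invariant.ac4 I (ι s) x (i , subst (O.Occ S (ι s) i) q os') (j , or'))

  preserve : Invariant T fr L → Invariant T fr L'
  preserve I = record
    { typed = typed-ι I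
    ; ac1   = λ x s i t j o₁ o₂ →
                let (e₁ , e₂) = Invariant.ac1 I x (ι s) i (ι t) j (own-back o₁) (own-back o₂)
                in ι-injective s t e₁ , e₂
    ; ac2   = λ s t (eq , ne) → dual-root s t eq ne (Invariant.ac2 I) ,
                                dual-root t s (sym eq) (λ q → ne (sym q)) (Invariant.ac2 I)
    ; ac3   = ac3-ι I
    ; ac4   = ac4-ι I
    ; ac5   = λ x fx s i o → Invariant.ac5 I x fx (ι s) i (own-back o)
    }

module Merge (T : ℕ → Ty) (fr : ℕ → Bool) (L : TypedList) (a b : ℕ)
             (a-free : ¬ Owned L a) (b-free : ¬ Owned L b) (same-type : T a ≡ T b) where
  L' : TypedList
  L' = map (renEntry (ren a b)) L

  ren-fixes-owned : ∀ x → Owned L x → ren a b x ≡ x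
  ren-fixes-owned x o = ren-other a b x (λ e → a-free (subst (Owned L) e o))

  ren-reflects-owned : ∀ y x → ren a b y ≡ x → Owned L x → y ≡ x
  ren-reflects-owned y x e o with ren-cases a b y
  ... | inj₁ (_ , e') = ⊥-elim (b-free (subst (Owned L) (trans (sym e) e') o))
  ... | inj₂ (_ , e') = trans (sym e') e

  ren-typed : ∀ x → T (ren a b x) ≡ T x
  ren-typed x with ren-cases a b x
  ... | inj₁ (refl , e) = trans (cong T e) (sym same-type)
  ... | inj₂ (_ , e)    = cong T e

  open Simulation T fr L L' (mapIx (renEntry (ren a b)) L) (ren a b)
         (lookup-mapIx (renEntry (ren a b)) L) (mapIx-injective (renEntry (ren a b)) L)
         ren-fixes-owned ren-reflects-owned ren-typed
         (λ _ c _ → mapIx⁻ (renEntry (ren a b)) L c , mapIx-mapIx⁻ (renEntry (ren a b)) L c)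
    public using (preserve; owned-back)

  unowned-ren : ∀ x → ¬ Owned L x → ¬ Owned L' (ren a b x)
  unowned-ren x x-free o with ren-cases a b x
  ... | inj₁ (_ , e) = b-free (subst (Owned L) e (owned-back o))
  ... | inj₂ (_ , e) = x-free (subst (Owned L) e (owned-back o))

-- Instance 2: deleting a root entry p.  Afterwards the objects of p are
-- unowned: their owner could only have been p.
module DeleteRoot (T : ℕ → Ty) (fr : ℕ → Bool) (X : TypedList) (p : Solo × Maybe Ty) (Y : TypedList)
                  (I : Invariant T fr (X ++ p ∷ Y))
                  (p-root : ¬ Owned (X ++ p ∷ Y) (subj (proj₁ p))) where
  L L' : TypedList
  L  = X ++ p ∷ Y
  L' = X ++ Y

  p-root-at-hole : ¬ Owned L (subj (Rel.sol L (holeIx X)))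
  p-root-at-hole = subst (λ e → ¬ Owned L (subj (proj₁ e))) (sym (lookup-hole X)) p-root

  kept-closed : ∀ k b → Rel._◁ₛ_ L (skipIx X k) b → ∃[ b' ] skipIx X b' ≡ b
  kept-closed k b (i , o) with hole-or-skip X b
  ... | inj₁ refl = ⊥-elim (p-root-at-hole (skipIx X k , i , o))
  ... | inj₂ r    = r

  private module S = Simulation T fr L L' (skipIx X) (λ x → x) (λ k → sym (lookup-skip X k))
                (skip-injective X) (λ _ _ → refl) (λ _ _ e _ → e) (λ _ → refl) kept-closed

  owned-back : ∀ {z} → Owned L' z → Owned L z
  owned-back = S.owned-back

  invariant : Invariant T fr L'
  invariant = S.preserve I

  objects-unowned : ∀ i → ¬ Owned L' (obj (proj₁ p) i)
  objects-unowned i (k , j , o) =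
    skip≢hole X k (root-name-owner I (skipIx X k) j _ (holeIx X) (S.own-back o)
      (i , cong (λ e → obj (proj₁ e) i) (lookup-hole X)) p-root-at-hole)

dual-roots : ∀ {T fr} L → Invariant T fr L → ∀ j k {p q} → lookup L j ≡ p → lookup L k ≡ q →
             Dual (edgeOf p) (edgeOf q) → ¬ Owned L (subj (proj₁ p)) × ¬ Owned L (subj (proj₁ q))
dual-roots L I j k refl refl dual with Invariant.ac2 I j k dual
... | j-root , k-root = root-unowned L j j-root , root-unowned L k k-root

Mergeable : (ℕ → Ty) → TypedList → ℕ × ℕ → Set
Mergeable T L (a , b) = ¬ Owned L a × ¬ Owned L b × T a ≡ T b

OkTy-unique : ∀ {t a b c a' b' c'} → OkTy t a b c → OkTy t a' b' c' → a ≡ a' × b ≡ b' × c ≡ c'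
OkTy-unique okV okV = refl , refl , refl
OkTy-unique okW okW = refl , refl , refl

-- Deleting a dual pair of roots keeps the invariant and makes every
-- identification edge of the pair mergeable: the objects of both solos
-- become unowned, and equal subjects force equal object types.
module DeleteDualPair (T : ℕ → Ty) (fr : ℕ → Bool) (LA : TypedList) (p : Solo × Maybe Ty)
                      (LB : TypedList) (q : Solo × Maybe Ty) (LC : TypedList)
                      (I : Invariant T fr (LA ++ p ∷ LB ++ q ∷ LC))
                      (p-root : ¬ Owned (LA ++ p ∷ LB ++ q ∷ LC) (subj (proj₁ p)))
                      (q-root : ¬ Owned (LA ++ p ∷ LB ++ q ∷ LC) (subj (proj₁ q))) where
  module D₁ = DeleteRoot T fr LA p (LB ++ q ∷ LC) I p-root

  regroup : LA ++ LB ++ q ∷ LC ≡ (LA ++ LB) ++ q ∷ LC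
  regroup = sym (++-assoc LA LB (q ∷ LC))

  I₁ : Invariant T fr ((LA ++ LB) ++ q ∷ LC)
  I₁ = subst (Invariant T fr) regroup D₁.invariant

  q-root₁ : ¬ Owned ((LA ++ LB) ++ q ∷ LC) (subj (proj₁ q))
  q-root₁ o = q-root (D₁.owned-back (subst (λ M → Owned M _) (sym regroup) o))

  module D₂ = DeleteRoot T fr (LA ++ LB) q LC I₁ q-root₁

  ungroup : (LA ++ LB) ++ LC ≡ LA ++ LB ++ LC
  ungroup = ++-assoc LA LB LC

  invariant : Invariant T fr (LA ++ LB ++ LC)
  invariant = subst (Invariant T fr) ungroup D₂.invariant

  p-objects : ∀ i → ¬ Owned (LA ++ LB ++ LC) (obj (proj₁ p) i)
  p-objects i o = D₁.objects-unowned i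
    (subst (λ M → Owned M _) (sym regroup) (D₂.owned-back (subst (λ M → Owned M _) (sym ungroup) o)))

  q-objects : ∀ i → ¬ Owned (LA ++ LB ++ LC) (obj (proj₁ q) i)
  q-objects i o = D₂.objects-unowned i (subst (λ M → Owned M _) (sym ungroup) o)

  p-typed : TypedEntry T p
  p-typed = subst (TypedEntry T) (lookup-hole LA) (Invariant.typed I (holeIx LA))

  q-typed : TypedEntry T q
  q-typed = subst (TypedEntry T) (lookup-hole (LA ++ LB)) (Invariant.typed I₁ (holeIx (LA ++ LB)))

  mergeable : subj (proj₁ p) ≡ subj (proj₁ q) → All (Mergeable T (LA ++ LB ++ LC)) (idEdges (edgeOf p) (edgeOf q))
  mergeable same-subj with OkTy-unique (proj₂ p-typed)
                             (subst (λ u → Typed T (record (proj₁ q) { subj = u })) (sym same-subj) (proj₂ q-typed))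
  ... | e₁ , e₂ , e₃ = (p-objects zero , q-objects zero , e₁)
                     ∷ (p-objects (suc zero) , q-objects (suc zero) , e₂)
                     ∷ (p-objects (suc (suc zero)) , q-objects (suc (suc zero)) , e₃) ∷ []

ContractionInvariant : (ℕ → Ty) → (ℕ → Bool) → State → Set
ContractionInvariant T fr (es , ids) = ∃[ L ] es ≡ map edgeOf L × Invariant T fr L × All (Mergeable T L) ids

renE-edges : ∀ a b L → map (renE a b) (map edgeOf L) ≡ map edgeOf (map (renEntry (ren a b)) L)
renE-edges a b []      = refl
renE-edges a b (x ∷ L) = cong (_ ∷_) (renE-edges a b L)

merge-step : ∀ {T fr} L a b → Invariant T fr L → Mergeable T L (a , b) → ∀ ids → All (Mergeable T L) ids →
             ContractionInvariant T fr (map (renE a b) (map edgeOf L) , map (renP a b) ids)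
merge-step {T} {fr} L a b I (a-free , b-free , same-type) ids pending =
  M.L' , renE-edges a b L , M.preserve I , gmap⁺ still-mergeable pending
  where
  module M = Merge T fr L a b a-free b-free same-type
  still-mergeable : ∀ {e} → Mergeable T L e → Mergeable T M.L' (renP a b e)
  still-mergeable {x , y} (x-free , y-free , xy) =
    M.unowned-ren x x-free , M.unowned-ren y y-free , trans (M.ren-typed x) (trans xy (sym (M.ren-typed y)))

mergeable-swap : ∀ {T : ℕ → Ty} {L a b} → Mergeable T L (a , b) → Mergeable T L (b , a)
mergeable-swap (a-free , b-free , ab) = b-free , a-free , sym ab

contract-step : ∀ {T fr st st'} → Contract fr st st' → ContractionInvariant T fr st → ContractionInvariant T fr st'
contract-step (c-loop k _) (L , e , I , pending) = L , e , I , All-removeAt pending k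
contract-step {T} (c-left {ids = ids} {a} {b} k eq _) (L , refl , I , pending) =
  merge-step L a b I (subst (Mergeable T L) eq (All-lookup pending k)) (removeAt ids k) (All-removeAt pending k)
contract-step {T} (c-right {ids = ids} {a} {b} k eq _) (L , refl , I , pending) =
  merge-step L b a I (mergeable-swap {T} {L} (subst (Mergeable T L) eq (All-lookup pending k))) (removeAt ids k) (All-removeAt pending k)

contract-star : ∀ {T fr st st'} → Star (Contract fr) st st' → ContractionInvariant T fr st → ContractionInvariant T fr st'
contract-star ε c = c
contract-star (s ◅ ss) c = contract-star ss (contract-step s c)

-- A reduction step of the diagram preserves the invariant: the dual pair
-- is deleted, and the contraction phase starts from mergeable edges.
step-preserves : ∀ {T G H} → DStep G H → ∀ L → edges G ≡ map edgeOf L → Invariant T (isFree G) L →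
                 ∃[ L' ] edges H ≡ map edgeOf L' × Invariant T (isFree H) L'
step-preserves {T} (dstep {fr} A e₁ B e₂ C dual contraction) L edges≡ I
  with map-split edgeOf L (sym edges≡)
... | LA , p , LW , refl , refl , refl , split with map-split edgeOf LW split
...   | LB , q , LC , refl , refl , refl , refl =
  let (p-root , q-root) = dual-roots _ I (holeIx LA) (hole₂Ix LA LB) (lookup-hole LA) (lookup-hole₂ LA LB) dual
      module D = DeleteDualPair T fr LA p LB q LC I p-root q-root
      edges-rest : map edgeOf LA ++ map edgeOf LB ++ map edgeOf LC ≡ map edgeOf (LA ++ LB ++ LC)
      edges-rest = sym (trans (map-++ edgeOf LA (LB ++ LC)) (cong (map edgeOf LA ++_) (map-++ edgeOf LB LC)))
      (L' , e , I' , _) = contract-star contraction (LA ++ LB ++ LC , edges-rest , D.invariant , D.mergeable (proj₁ dual))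
  in L' , e , I'

reachable-preserves : ∀ {T G H} → Star DStep G H → ∀ L → edges G ≡ map edgeOf L → Invariant T (isFree G) L →
                      ∃[ L' ] edges H ≡ map edgeOf L' × Invariant T (isFree H) L'
reachable-preserves ε L e I = L , e , I
reachable-preserves (s ◅ ss) L e I with step-preserves s L e I
... | L' , e' , I' = reachable-preserves ss L' e' I'

module Cycles (E : List (ℕ × ℕ)) where

  Touches : Fin (length E) → ℕ → Set
  Touches l w = proj₁ (lookup E l) ≡ w ⊎ proj₂ (lookup E l) ≡ w

  Loop : Fin (length E) → Set
  Loop l = proj₁ (lookup E l) ≡ proj₂ (lookup E l)

  Closed : List (Fin (length E)) → Set
  Closed ls = ∀ j → j ∈ ls → ∀ w → Touches j w → Loop j ⊎ ∃[ l ] (l ∈ ls × l ≢ j × Touches l w)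

  trail-split : ∀ {a b} xs {ys} → Trail E a b (xs ++ ys) → ∃[ c ] Trail E a c xs × Trail E c b ys
  trail-split []       t       = _ , [] , t
  trail-split (x ∷ xs) (j ∷ t) with trail-split xs t
  ... | c , t₁ , t₂ = c , j ∷ t₁ , t₂

  joins-touch : ∀ {l c d} → Joins (lookup E l) c d → Touches l c × Touches l d
  joins-touch (inj₁ (e₁ , e₂)) = inj₁ e₁ , inj₂ e₂
  joins-touch (inj₂ (e₁ , e₂)) = inj₂ e₂ , inj₁ e₁

  touch-joins : ∀ {l c d w} → Joins (lookup E l) c d → Touches l w → w ≡ c ⊎ w ≡ d
  touch-joins (inj₁ (e₁ , e₂)) (inj₁ t) = inj₁ (trans (sym t) e₁)
  touch-joins (inj₁ (e₁ , e₂)) (inj₂ t) = inj₂ (trans (sym t) e₂)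
  touch-joins (inj₂ (e₁ , e₂)) (inj₁ t) = inj₂ (trans (sym t) e₁)
  touch-joins (inj₂ (e₁ , e₂)) (inj₂ t) = inj₁ (trans (sym t) e₂)

  joins-loop : ∀ {l c} → Joins (lookup E l) c c → Loop l
  joins-loop (inj₁ (e₁ , e₂)) = trans e₁ (sym e₂)
  joins-loop (inj₂ (e₁ , e₂)) = trans e₁ (sym e₂)

  first-touch : ∀ {a b l ls} → Trail E a b (l ∷ ls) → Touches l a
  first-touch (j ∷ _) = proj₁ (joins-touch j)

  last-touch : ∀ {a b l ls} → Trail E a b (l ∷ ls) → ∃[ m ] m ∈ (l ∷ ls) × Touches m b
  last-touch (j ∷ [])       = _ , here refl , proj₂ (joins-touch j)
  last-touch (j ∷ (j' ∷ t)) with last-touch (j' ∷ t)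
  ... | m , m∈ , tm = m , there m∈ , tm

  unique-before : ∀ {j l : Fin (length E)} xs ys → Unique (xs ++ j ∷ ys) → l ∈ xs → l ≢ j
  unique-before (x ∷ xs) ys (a ∷ _) (here refl) = All.lookup a (∈-++⁺ʳ xs (here refl))
  unique-before (x ∷ xs) ys (_ ∷ u) (there m)   = unique-before xs ys u m

  unique-after : ∀ {j l : Fin (length E)} xs ys → Unique (xs ++ j ∷ ys) → l ∈ ys → l ≢ j
  unique-after []       ys (a ∷ _) m e = All.lookup a m (sym e)
  unique-after (x ∷ xs) ys (_ ∷ u) m   = unique-after xs ys u m

  neighbour-touch : ∀ {v c d j w} xs ys → Trail E v c xs → Trail E d v ys → Joins (lookup E j) c d →
                    Touches j w → Loop j ⊎ (∃[ l ] (l ∈ xs × Touches l w)) ⊎ (∃[ l ] (l ∈ ys × Touches l w))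
  neighbour-touch xs ys tx ty jn tw with touch-joins jn tw
  neighbour-touch []       []       []  []  jn tw | _         = inj₁ (joins-loop jn)
  neighbour-touch xs       (y ∷ ys) tx  ty  jn tw | inj₂ refl = inj₂ (inj₂ (y , here refl , first-touch ty))
  neighbour-touch (x ∷ xs) []       tx  []  jn tw | inj₂ refl = inj₂ (inj₁ (x , here refl , first-touch tx))
  neighbour-touch (x ∷ xs) ys       tx  ty  jn tw | inj₁ refl with last-touch tx
  ... | m , m∈ , t = inj₂ (inj₁ (m , m∈ , t))
  neighbour-touch []       (y ∷ ys) []  ty  jn tw | inj₁ refl with last-touch ty
  ... | m , m∈ , t = inj₂ (inj₂ (m , m∈ , t))

  cycle-closed : HasCycle E → ∃[ ls ] ∃[ j ] (j ∈ ls × Closed ls)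
  cycle-closed (v , i , is , trail , unique) = i ∷ is , i , here refl , closed
    where
    closed : Closed (i ∷ is)
    closed j j∈ w tw with ∈-∃++ j∈
    ... | xs , ys , eq with trail-split xs (subst (Trail E v v) eq trail)
    ...   | c , tx , (jn ∷ ty) with neighbour-touch xs ys tx ty jn tw
    ...     | inj₁ lp = inj₁ lp
    ...     | inj₂ (inj₁ (l , m , t)) =
      inj₂ (l , subst (_ ∈_) (sym eq) (∈-++⁺ˡ m) , unique-before xs ys (subst Unique eq unique) m , t)
    ...     | inj₂ (inj₂ (l , m , t)) =
      inj₂ (l , subst (_ ∈_) (sym eq) (∈-++⁺ʳ xs (there m)) , unique-after xs ys (subst Unique eq unique) m , t)

-- Contraction by pivots: each identification edge contains its pivot.  If
-- the pivots are distinct and bound, contracting the edges in order, each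
-- by eliminating its pivot, succeeds, since earlier renamings leave the
-- later pivots in place.
data Pivots : List ℕ → List (ℕ × ℕ) → Set where
  []  : Pivots [] []
  _∷_ : ∀ {r rs a b ids} → (a ≡ r ⊎ b ≡ r) → Pivots rs ids → Pivots (r ∷ rs) ((a , b) ∷ ids)

pivots-ren : ∀ c d {rs ids} → All (c ≢_) rs → Pivots rs ids → Pivots rs (map (renP c d) ids)
pivots-ren c d []         []                = []
pivots-ren c d (c≢r ∷ ns) (inj₁ refl ∷ pvs) = inj₁ (ren-other c d _ (λ e → c≢r (sym e))) ∷ pivots-ren c d ns pvs
pivots-ren c d (c≢r ∷ ns) (inj₂ refl ∷ pvs) = inj₂ (ren-other c d _ (λ e → c≢r (sym e))) ∷ pivots-ren c d ns pvs

contract-pivots : ∀ fr es ids rs → Pivots rs ids → AllPairs _≢_ rs → All (λ r → fr r ≡ false) rs →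
                  ∃[ es' ] Succeeds fr es ids es'
contract-pivots fr es [] [] [] _ _ = es , ε
contract-pivots fr es ((r , b) ∷ ids) (r ∷ rs) (inj₁ refl ∷ pvs) (r≢ ∷ distinct) (bound ∷ bounds)
  with contract-pivots fr (map (renE r b) es) (map (renP r b) ids) rs (pivots-ren r b r≢ pvs) distinct bounds
... | es' , steps = es' , (c-left zero refl bound ◅ steps)
contract-pivots fr es ((a , r) ∷ ids) (r ∷ rs) (inj₂ refl ∷ pvs) (r≢ ∷ distinct) (bound ∷ bounds)
  with contract-pivots fr (map (renE r a) es) (map (renP r a) ids) rs (pivots-ren r a r≢ pvs) distinct bounds
... | es' , steps = es' , (c-right zero refl bound ◅ steps)

flip : Prot → Prot
flip R = S
flip S = R

prot-out : ∀ ty i → prot out ty i ≡ flip (prot inp ty i)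
prot-out V zero             = refl
prot-out V (suc zero)       = refl
prot-out V (suc (suc zero)) = refl
prot-out W zero             = refl
prot-out W (suc zero)       = refl
prot-out W (suc (suc zero)) = refl

complementary : ∀ p₁ p₂ ty i → p₁ ≢ p₂ →
                (prot p₁ ty i ≡ R × prot p₂ ty i ≡ S) ⊎ (prot p₁ ty i ≡ S × prot p₂ ty i ≡ R)
complementary inp inp ty i ne = ⊥-elim (ne refl)
complementary out out ty i ne = ⊥-elim (ne refl)
complementary inp out ty i ne rewrite prot-out ty i with prot inp ty i
... | R = inj₁ (refl , refl)
... | S = inj₂ (refl , refl)
complementary out inp ty i ne rewrite prot-out ty i with prot inp ty i
... | R = inj₂ (refl , refl)
... | S = inj₁ (refl , refl)

module DualPair (T : ℕ → Ty) (fr : ℕ → Bool) (L : TypedList) (I : Invariant T fr L)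
                (j k : Fin (length L)) (dual : Rel._⊥_ L j k) where
  open Rel L
  open Invariant I

  E : List (ℕ × ℕ)
  E = idEdges (edgeOf (lookup L j)) (edgeOf (lookup L k))
  open Cycles E

  lookup-E : ∀ i → lookup E i ≡ (obj (sol j) i , obj (sol k) i)
  lookup-E zero             = refl
  lookup-E (suc zero)       = refl
  lookup-E (suc (suc zero)) = refl

  prot-at : ∀ b i → protOf (lookup L b) i ≡ just (prot (pol (sol b)) (T (subj (sol b))) i)
  prot-at b i = cong (Maybe.map (λ ty → prot (pol (sol b)) ty i)) (proj₁ (typed b))

  IsPair : Ix → Ix → Set
  IsPair a b = (a ≡ j × b ≡ k) ⊎ (a ≡ k × b ≡ j)

  Member : Ix → Set
  Member c = c ≡ j ⊎ c ≡ k

  pair-pol : ∀ {a b} → IsPair a b → pol (sol a) ≢ pol (sol b)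
  pair-pol (inj₁ (refl , refl)) = proj₂ dual
  pair-pol (inj₂ (refl , refl)) = λ e → proj₂ dual (sym e)

  pair-distinct : ∀ {a b} → IsPair a b → a ≢ b
  pair-distinct ab refl = pair-pol ab refl

  pair-covers : ∀ {a b c} → IsPair a b → Member c → c ≡ a ⊎ c ≡ b
  pair-covers (inj₁ (refl , refl)) (inj₁ e) = inj₁ e
  pair-covers (inj₁ (refl , refl)) (inj₂ e) = inj₂ e
  pair-covers (inj₂ (refl , refl)) (inj₁ e) = inj₂ e
  pair-covers (inj₂ (refl , refl)) (inj₂ e) = inj₁ e

  pair-second : ∀ {a b} → IsPair a b → Member b
  pair-second (inj₁ (_ , e)) = inj₂ e
  pair-second (inj₂ (_ , e)) = inj₁ e

  member-root : ∀ c → Member c → ¬ Owned L (subj (sol c))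
  member-root c (inj₁ refl) = root-unowned L j (proj₁ (ac2 j k dual))
  member-root c (inj₂ refl) = root-unowned L k (proj₂ (ac2 j k dual))

  record Split (i : Fin 3) : Set where
    field
      owner partner : Ix
      is-pair       : IsPair owner partner
      owner-R       : Occ R owner i (obj (sol owner) i)
      partner-S     : Occ S partner i (obj (sol partner) i)

  k-prot : ∀ i → prot (pol (sol k)) (T (subj (sol k))) i ≡ prot (pol (sol k)) (T (subj (sol j))) i
  k-prot i = cong (λ u → prot (pol (sol k)) (T u) i) (sym (proj₁ dual))

  split : ∀ i → Split i
  split i with complementary (pol (sol j)) (pol (sol k)) (T (subj (sol j))) i (proj₂ dual)
  ... | inj₁ (jR , kS) = record
    { owner = j ; partner = k ; is-pair = inj₁ (refl , refl)
    ; owner-R = refl , trans (prot-at j i) (cong just jR)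
    ; partner-S = refl , trans (prot-at k i) (cong just (trans (k-prot i) kS)) }
  ... | inj₂ (jS , kR) = record
    { owner = k ; partner = j ; is-pair = inj₂ (refl , refl)
    ; owner-R = refl , trans (prot-at k i) (cong just (trans (k-prot i) kR))
    ; partner-S = refl , trans (prot-at j i) (cong just jS) }

  owner partner : Fin 3 → Ix
  owner i   = Split.owner (split i)
  partner i = Split.partner (split i)

  pivot : Fin 3 → ℕ
  pivot i = obj (sol (owner i)) i

  pivot-R : ∀ i → Occ R (owner i) i (pivot i)
  pivot-R i = Split.owner-R (split i)

  pivot-in-edge : ∀ i → Touches i (pivot i)
  pivot-in-edge i rewrite lookup-E i with Split.is-pair (split i)
  ... | inj₁ (e , _) = inj₁ (cong (λ c → obj (sol c) i) (sym e))
  ... | inj₂ (e , _) = inj₂ (cong (λ c → obj (sol c) i) (sym e))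

  touch-location : ∀ l w → Touches l w → ∃[ c ] Member c × obj (sol c) l ≡ w
  touch-location l w tw rewrite lookup-E l with tw
  ... | inj₁ e = j , inj₁ refl , e
  ... | inj₂ e = k , inj₂ refl , e

  -- If another edge l touches pivot i, then the owner of i is the partner
  -- at l (by AC1 it cannot own a second occurrence), so it carries both an
  -- S- and an R-occurrence of the pivot and is an input (AC4).
  pivot-shared : ∀ i l → l ≢ i → Touches l (pivot i) → pol (sol (owner i)) ≡ inp × owner i ≡ partner l
  pivot-shared i l l≢i tw with touch-location l (pivot i) tw
  ... | c , c-member , e with root-name-owner I (owner i) i (pivot i) c (pivot-R i) (l , e) (member-root c c-member)
  ...   | refl with pair-covers (Split.is-pair (split l)) c-member
  ...     | inj₁ c≡owner = ⊥-elim (l≢i (proj₂ (ac1 (pivot i) (owner i) l (owner i) i owned-at-l (pivot-R i))))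
    where
    owned-at-l : Occ R (owner i) l (pivot i)
    owned-at-l = e , proj₂ (subst (λ z → Occ R z l (obj (sol z) l)) (sym c≡owner) (Split.owner-R (split l)))
  ...     | inj₂ c≡partner = ac4 (owner i) (pivot i) (l , shared-at-l) (i , pivot-R i) , c≡partner
    where
    shared-at-l : Occ S (owner i) l (pivot i)
    shared-at-l = e , proj₂ (subst (λ z → Occ S z l (obj (sol z) l)) (sym c≡partner) (Split.partner-S (split l)))

  pair-same-object : ∀ {a b} i → IsPair a b → obj (sol j) i ≡ obj (sol k) i → obj (sol b) i ≡ obj (sol a) i
  pair-same-object i (inj₁ (refl , refl)) e = sym e
  pair-same-object i (inj₂ (refl , refl)) e = e

  -- No edge is a loop: the pivot would occur in the partner, a root.
  no-loop : ∀ i → ¬ Loop i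
  no-loop i loop = pair-distinct pair
    (root-name-owner I (owner i) i (pivot i) (partner i) (pivot-R i)
      (i , pair-same-object i pair (subst (λ e → proj₁ e ≡ proj₂ e) (lookup-E i) loop))
      (member-root (partner i) (pair-second pair)))
    where
    pair : IsPair (owner i) (partner i)
    pair = Split.is-pair (split i)

  -- A cycle yields edges j₀, l, m with pivot j₀ in l and pivot l in m; then
  -- owner j₀ = partner l and owner l are both inputs, contradicting that the
  -- owner and partner of l have different polarities.
  no-cycle : ¬ HasCycle E
  no-cycle cycle with cycle-closed cycle
  ... | ls , j₀ , j₀∈ , closed with closed j₀ j₀∈ (pivot j₀) (pivot-in-edge j₀)
  ...   | inj₁ loop = no-loop j₀ loop
  ...   | inj₂ (l , l∈ , l≢j₀ , tl) with pivot-shared j₀ l l≢j₀ tl | closed l l∈ (pivot l) (pivot-in-edge l)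
  ...     | _ | inj₁ loop = no-loop l loop
  ...     | j₀-inp , owner≡partner | inj₂ (m , _ , m≢l , tm) with pivot-shared l m m≢l tm
  ...       | l-inp , _ = pair-pol (Split.is-pair (split l))
                            (trans l-inp (sym (subst (λ z → pol (sol z) ≡ inp) owner≡partner j₀-inp)))

  pivot-injective : ∀ i i' → pivot i ≡ pivot i' → i ≡ i'
  pivot-injective i i' e = proj₂ (ac1 (pivot i') (owner i) i (owner i') i' (subst (Occ R (owner i) i) e (pivot-R i)) (pivot-R i'))

  pivot-bound : ∀ i → fr (pivot i) ≡ false
  pivot-bound i with fr (pivot i) in eq
  ... | true  = ⊥-elim (ac5 (pivot i) eq (owner i) i (pivot-R i))
  ... | false = refl

  contraction-succeeds : ∀ es → ∃[ es' ] Succeeds fr es E es'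
  contraction-succeeds es = contract-pivots fr es E (pivot z₀ ∷ pivot z₁ ∷ pivot z₂ ∷ [])
    (pivot-in-edge z₀ ∷ pivot-in-edge z₁ ∷ pivot-in-edge z₂ ∷ [])
    ((distinct z₀ z₁ (λ ()) ∷ distinct z₀ z₂ (λ ()) ∷ []) ∷ (distinct z₁ z₂ (λ ()) ∷ []) ∷ [] ∷ [])
    (pivot-bound z₀ ∷ pivot-bound z₁ ∷ pivot-bound z₂ ∷ [])
    where
    z₀ z₁ z₂ : Fin 3
    z₀ = zero
    z₁ = suc zero
    z₂ = suc (suc zero)
    distinct : ∀ i i' → i ≢ i' → pivot i ≢ pivot i'
    distinct i i' ne e = ne (pivot-injective i i' e)

dual-redex-acyclic : ∀ {T fr} L → Invariant T fr L → ∀ A e₁ B e₂ C → map edgeOf L ≡ A ++ e₁ ∷ B ++ e₂ ∷ C →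
                     Dual e₁ e₂ → AcyclicRedex fr A e₁ B e₂ C
dual-redex-acyclic {T} {fr} L I A e₁ B e₂ C edges≡ dual with map-split edgeOf L edges≡
... | LA , p , LW , refl , refl , refl , split with map-split edgeOf LW split
...   | LB , q , LC , refl , refl , refl , refl = redex (lookup-hole LA) (lookup-hole₂ LA LB) dual
  where
  L₀ : TypedList
  L₀ = LA ++ p ∷ LB ++ q ∷ LC
  redex : ∀ {p' q'} → lookup L₀ (holeIx LA) ≡ p' → lookup L₀ (hole₂Ix LA LB) ≡ q' →
          Dual (edgeOf p') (edgeOf q') → AcyclicRedex fr (map edgeOf LA) (edgeOf p') (map edgeOf LB) (edgeOf q') (map edgeOf LC)
  redex refl refl dual' = D.contraction-succeeds _ , D.no-cycle
    where module D = DualPair T fr L₀ I (holeIx LA) (hole₂Ix LA LB) dual'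

-- Since bound names are pairwise distinct and
-- distinct from the free ones, the local environments of a well-typed term
-- are all restrictions of a single global typing of names.

names : Solo → List ℕ
names s = subj s ∷ o₁ s ∷ o₂ s ∷ o₃ s ∷ []

bound-or-free : ∀ Γ P e → e ∈ tsolos Γ P → ∀ x → x ∈ names (proj₁ e) → x ∈ bnames P ⊎ x ∈ fv P
bound-or-free Γ (solo p u a b c) e (here refl) x x∈ = inj₂ x∈
bound-or-free Γ (par P Q) e e∈ x x∈ with ∈-++⁻ (tsolos Γ P) e∈
... | inj₁ e∈P with bound-or-free Γ P e e∈P x x∈
...   | inj₁ bound = inj₁ (∈-++⁺ˡ bound)
...   | inj₂ free  = inj₂ (∈-++⁺ˡ free)
bound-or-free Γ (par P Q) e e∈ x x∈ | inj₂ e∈Q with bound-or-free Γ Q e e∈Q x x∈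
...   | inj₁ bound = inj₁ (∈-++⁺ʳ (bnames P) bound)
...   | inj₂ free  = inj₂ (∈-++⁺ʳ (fv P) free)
bound-or-free Γ (nu y U P) e e∈ x x∈ with bound-or-free (Γ [ y ↦ U ]) P e e∈ x x∈
... | inj₁ bound = inj₁ (there bound)
... | inj₂ free with x ≟ y
...   | yes x≡y = inj₁ (here x≡y)
...   | no x≢y  = inj₂ (∈-filter⁺ (λ z → ¬? (z ≟ y)) free x≢y)

unique-++ˡ : ∀ (xs : List ℕ) {ys} → Unique (xs ++ ys) → Unique xs
unique-++ˡ []       _       = []
unique-++ˡ (x ∷ xs) (a ∷ u) = All.tabulate (λ m → All.lookup a (∈-++⁺ˡ m)) ∷ unique-++ˡ xs u

unique-++ʳ : ∀ (xs : List ℕ) {ys} → Unique (xs ++ ys) → Unique ys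
unique-++ʳ []       u       = u
unique-++ʳ (x ∷ xs) (_ ∷ u) = unique-++ʳ xs u

unique-disjoint : ∀ {x} (xs ys : List ℕ) → Unique (xs ++ ys) → x ∈ xs → x ∉ ys
unique-disjoint (z ∷ xs) ys (a ∷ _) (here refl) m = All.lookup a (∈-++⁺ʳ xs m) refl
unique-disjoint (z ∷ xs) ys (_ ∷ u) (there m)   m' = unique-disjoint xs ys u m m'

well-named-parˡ : ∀ {P Q} → WellNamed (par P Q) → WellNamed P
well-named-parˡ {P} (u , d) = unique-++ˡ (bnames P) u , λ x m v → d x (∈-++⁺ˡ m) (∈-++⁺ˡ v)

well-named-parʳ : ∀ {P Q} → WellNamed (par P Q) → WellNamed Q
well-named-parʳ {P} (u , d) = unique-++ʳ (bnames P) u , λ x m v → d x (∈-++⁺ʳ (bnames P) m) (∈-++⁺ʳ (fv P) v)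

well-named-nu : ∀ {y U P} → WellNamed (nu y U P) → WellNamed P
well-named-nu {y} (a ∷ u , d) =
  u , λ x m v → d x (there m) (∈-filter⁺ (λ z → ¬? (z ≟ y)) v (λ e → All.lookup a m (sym e)))

update-other : ∀ Γ y U x → x ≢ y → (Γ [ y ↦ U ]) x ≡ Γ x
update-other Γ y U x x≢y = cong (λ c → if c then just U else Γ x) (dec-false (x ≟ y) x≢y)

typeOf : Env → ℕ → Ty
typeOf Γ x = fromMaybe V (Γ x)

typeOf-defined : ∀ {m : Maybe Ty} {t} → m ≡ just t → m ≡ just (fromMaybe V m)
typeOf-defined refl = refl

typeOf-just : ∀ {m : Maybe Ty} {t} → m ≡ just t → fromMaybe V m ≡ t
typeOf-just refl = refl

glue : List ℕ → (ℕ → Ty) → (ℕ → Ty) → ℕ → Ty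
glue xs T₁ T₂ x = if does (x ∈? xs) then T₁ x else T₂ x

glue-in : ∀ xs T₁ T₂ {x} → x ∈ xs → glue xs T₁ T₂ x ≡ T₁ x
glue-in xs T₁ T₂ {x} m = cong (λ c → if c then T₁ x else T₂ x) (dec-true (x ∈? xs) m)

glue-out : ∀ xs T₁ T₂ {x} → x ∉ xs → glue xs T₁ T₂ x ≡ T₂ x
glue-out xs T₁ T₂ {x} m = cong (λ c → if c then T₁ x else T₂ x) (dec-false (x ∈? xs) m)

OkTy-cong : ∀ {t a b c t' a' b' c'} → t ≡ t' → a ≡ a' → b ≡ b' → c ≡ c' → OkTy t a b c → OkTy t' a' b' c'
OkTy-cong refl refl refl refl ok = ok

typed-agree : ∀ {T T'} s m → (∀ x → x ∈ names s → T x ≡ T' x) → TypedEntry T' (s , m) → TypedEntry T (s , m)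
typed-agree {T} {T'} (mkSolo p u a b c) m agree (e , ty) =
  trans e (cong just (sym agree-u)) ,
  OkTy-cong (sym agree-u) (sym (agree a (there (here refl))))
            (sym (agree b (there (there (here refl))))) (sym (agree c (there (there (there (here refl)))))) ty
  where
  agree-u : T u ≡ T' u
  agree-u = agree u (here refl)

ScopeAgrees : Env → (ℕ → Ty) → Term → Set
ScopeAgrees Γ T P = ∀ e → e ∈ tsolos Γ P → ∀ x → x ∈ names (proj₁ e) → x ∉ bnames P → Γ x ≡ just (T x)

-- Gluing the typings of the two components of a parallel composition:
-- names bound in P or in Q (disjoint sets) take their component's type,
-- all others their type in Γ, on which both components agree.
module GlueTypings (Γ : Env) (P Q : Term) (wn : WellNamed (par P Q)) (TP TQ : ℕ → Ty)
                   (typedP : All (TypedEntry TP) (tsolos Γ P)) (agreesP : ScopeAgrees Γ TP P)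
                   (typedQ : All (TypedEntry TQ) (tsolos Γ Q)) (agreesQ : ScopeAgrees Γ TQ Q) where
  TQΓ : ℕ → Ty
  TQΓ = glue (bnames Q) TQ (typeOf Γ)

  T : ℕ → Ty
  T = glue (bnames P) TP TQΓ

  outside : ∀ {x} → x ∉ bnames P → x ∉ bnames Q → T x ≡ typeOf Γ x
  outside x∉P x∉Q = trans (glue-out (bnames P) TP TQΓ x∉P) (glue-out (bnames Q) TQ (typeOf Γ) x∉Q)

  inside-P : ∀ {x} → x ∈ bnames P → T x ≡ TP x
  inside-P = glue-in (bnames P) TP TQΓ

  inside-Q : ∀ {x} → x ∉ bnames P → x ∈ bnames Q → T x ≡ TQ x
  inside-Q x∉P x∈Q = trans (glue-out (bnames P) TP TQΓ x∉P) (glue-in (bnames Q) TQ (typeOf Γ) x∈Q)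

  not-bound-and-free : ∀ {x} → x ∈ fv (par P Q) → x ∉ bnames (par P Q)
  not-bound-and-free v b = proj₂ wn _ b v

  agreeP : ∀ e → e ∈ tsolos Γ P → ∀ x → x ∈ names (proj₁ e) → T x ≡ TP x
  agreeP e e∈ x x∈ with toSum (x ∈? bnames P)
  ... | inj₁ b = inside-P b
  ... | inj₂ nb with bound-or-free Γ P e e∈ x x∈
  ...   | inj₁ b = ⊥-elim (nb b)
  ...   | inj₂ v = trans (outside nb (λ bq → not-bound-and-free (∈-++⁺ˡ v) (∈-++⁺ʳ (bnames P) bq)))
                         (typeOf-just (agreesP e e∈ x x∈ nb))

  agreeQ : ∀ e → e ∈ tsolos Γ Q → ∀ x → x ∈ names (proj₁ e) → T x ≡ TQ x
  agreeQ e e∈ x x∈ with toSum (x ∈? bnames Q)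
  ... | inj₁ b = inside-Q (λ bp → unique-disjoint (bnames P) (bnames Q) (proj₁ wn) bp b) b
  ... | inj₂ nb with bound-or-free Γ Q e e∈ x x∈
  ...   | inj₁ b = ⊥-elim (nb b)
  ...   | inj₂ v = trans (outside (λ bp → not-bound-and-free (∈-++⁺ʳ (fv P) v) (∈-++⁺ˡ bp)) nb)
                         (typeOf-just (agreesQ e e∈ x x∈ nb))

  typedP′ : ∀ {e} → e ∈ tsolos Γ P → TypedEntry T e
  typedP′ {s , m} e∈ = typed-agree s m (agreeP (s , m) e∈) (All.lookup typedP e∈)

  typedQ′ : ∀ {e} → e ∈ tsolos Γ Q → TypedEntry T e
  typedQ′ {s , m} e∈ = typed-agree s m (agreeQ (s , m) e∈) (All.lookup typedQ e∈)

  typed : All (TypedEntry T) (tsolos Γ (par P Q))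
  typed = ++⁺ (All.tabulate typedP′) (All.tabulate typedQ′)

  agrees : ScopeAgrees Γ T (par P Q)
  agrees e e∈ x x∈ x∉ = trans (typeOf-defined (proj₂ (defined (∈-++⁻ (tsolos Γ P) e∈))))
                               (cong just (sym (outside x∉P x∉Q)))
    where
    x∉P : x ∉ bnames P
    x∉P b = x∉ (∈-++⁺ˡ b)
    x∉Q : x ∉ bnames Q
    x∉Q b = x∉ (∈-++⁺ʳ (bnames P) b)
    defined : e ∈ tsolos Γ P ⊎ e ∈ tsolos Γ Q → ∃[ t ] Γ x ≡ just t
    defined (inj₁ e∈P) = TP x , agreesP e e∈P x x∈ x∉P
    defined (inj₂ e∈Q) = TQ x , agreesQ e e∈Q x x∈ x∉Q

global-typing : ∀ Γ P → Γ ⊢ P → WellNamed P → ∃[ T ] All (TypedEntry T) (tsolos Γ P) × ScopeAgrees Γ T P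
global-typing Γ nil t-nil _ = (λ _ → V) , [] , λ _ ()
global-typing Γ (solo p u a b c) (t-solo {tu = tu} {ta} {tb} {tc} gu ga gb gc ok) _ =
  typeOf Γ , (typeOf-defined gu , ok′) ∷ [] , agrees
  where
  ok′ : OkTy (typeOf Γ u) (typeOf Γ a) (typeOf Γ b) (typeOf Γ c)
  ok′ = OkTy-cong (sym (typeOf-just gu)) (sym (typeOf-just ga)) (sym (typeOf-just gb)) (sym (typeOf-just gc)) ok
  agrees : ScopeAgrees Γ (typeOf Γ) (solo p u a b c)
  agrees _ (here refl) x (here refl)                         _ = typeOf-defined gu
  agrees _ (here refl) x (there (here refl))                 _ = typeOf-defined ga
  agrees _ (here refl) x (there (there (here refl)))         _ = typeOf-defined gb
  agrees _ (here refl) x (there (there (there (here refl)))) _ = typeOf-defined gc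
global-typing Γ (nu y U P) (t-nu ⊢P) wn with global-typing (Γ [ y ↦ U ]) P ⊢P (well-named-nu {y} {U} {P} wn)
... | T , typed , agrees = T , typed , λ e e∈ x x∈ x∉ →
  trans (sym (update-other Γ y U x (λ x≡y → x∉ (here x≡y)))) (agrees e e∈ x x∈ (λ b → x∉ (there b)))
global-typing Γ (par P Q) (t-par ⊢P ⊢Q) wn
  with global-typing Γ P ⊢P (well-named-parˡ {P} {Q} wn) | global-typing Γ Q ⊢Q (well-named-parʳ {P} {Q} wn)
... | TP , typedP , agreesP | TQ , typedQ , agreesQ = G.T , G.typed , G.agrees
  where module G = GlueTypings Γ P Q wn TP TQ typedP agreesP typedQ agreesQ

edges-of-term : ∀ Γ P → map edgeOf (tsolos Γ P) ≡ map soloEdge (solos P)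
edges-of-term Γ nil              = refl
edges-of-term Γ (solo p u a b c) = refl
edges-of-term Γ (par P Q)        = begin
  map edgeOf (tsolos Γ P ++ tsolos Γ Q)                      ≡⟨ map-++ edgeOf (tsolos Γ P) (tsolos Γ Q) ⟩
  map edgeOf (tsolos Γ P) ++ map edgeOf (tsolos Γ Q)         ≡⟨ cong₂ _++_ (edges-of-term Γ P) (edges-of-term Γ Q) ⟩
  map soloEdge (solos P) ++ map soloEdge (solos Q)           ≡⟨ sym (map-++ soloEdge (solos P) (solos Q)) ⟩
  map soloEdge (solos P ++ solos Q)                          ∎
  where open ≡-Reasoning
edges-of-term Γ (nu y U P)       = edges-of-term (Γ [ y ↦ U ]) P

free-member : ∀ x xs → does (x ∈? xs) ≡ true → x ∈ xs
free-member x xs eq with x ∈? xs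
... | yes m = m

initial-invariant : ∀ Γ P → WellNamed P → AcyclicTerm Γ P →
                    ∃[ T ] Invariant T (isFree (diagramOf P)) (tsolos Γ P)
initial-invariant Γ P wn (⊢P , ac1 , ac2 , ac3 , ac4 , ac5) with global-typing Γ P ⊢P wn
... | T , typed , _ = T , record
  { typed = All-lookup typed ; ac1 = ac1 ; ac2 = ac2 ; ac3 = ac3 ; ac4 = ac4
  ; ac5 = λ x free → ac5 x (free-member x (fv P) free) }

theorem5p14 : (Γ : Env) (P : Term) → WellNamed P → AcyclicTerm Γ P → AcyclicDiagram (diagramOf P)
theorem5p14 Γ P wn acyclic H P↠H A e₁ B e₂ C edges-H dual with initial-invariant Γ P wn acyclic
... | T , I₀ with reachable-preserves P↠H (tsolos Γ P) (sym (edges-of-term Γ P)) I₀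
...   | L , edges≡ , I = dual-redex-acyclic L I A e₁ B e₂ C (trans (sym edges≡) edges-H) dual
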